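{- The least positive integer $k$ for which there exists a Borwein polynomial with exactly $k$ nonzero coefficients that divides no Littlewood polynomial is $k=4$.
   Context: A polynomial $P(X)=a_dX^d+\dots+a_0\in\mathbb{Z}[X]$ is a Borwein polynomial if all $a_j\in\{ -1,0,1\}$, $a_d\ne0$ and $a_0\neq0$. It is a Littlewood polynomial if all $a_j\in\{ -1,1\}$. "Divides" means divisibility in $\mathbb{Z}[X]$. -}

module Defs where

open import Data.Nat using (ℕ; zero; suc)
open import Data.Integer using (ℤ; _+_; _*_; -[1+_]; +_; 0ℤ; 1ℤ)
open import Data.List using (List; []; _∷_; map)
open import Data.List.Relation.Unary.All using (All)
open import Data.Maybe using (Maybe; just; nothing)
open import Data.Product using (∃; _×_)
open import Data.Sum using (_⊎_)
open import Data.Empty using (⊥)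
open import Relation.Binary.PropositionalEquality using (_≡_; _≢_)

-- A polynomial a_0 + a_1 X + ... + a_d X^d in ℤ[X] is represented by the
-- list of its coefficients [a_0, a_1, ..., a_d] (constant term first).
Poly : Set
Poly = List ℤ

coeff : Poly → ℕ → ℤ
coeff []      n       = 0ℤ
coeff (a ∷ p) zero    = a
coeff (a ∷ p) (suc n) = coeff p n

_+ₚ_ : Poly → Poly → Poly
[]      +ₚ q       = q
(a ∷ p) +ₚ []      = a ∷ p
(a ∷ p) +ₚ (b ∷ q) = (a + b) ∷ (p +ₚ q)

_*ₚ_ : Poly → Poly → Poly
[]      *ₚ q = []
(a ∷ p) *ₚ q = map (a *_) q +ₚ (0ℤ ∷ (p *ₚ q))

-- divisibility in ℤ[X]: Q = P * R for some R ∈ ℤ[X] (equality of polynomials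
-- = equality of all coefficients)
_∣ₚ_ : Poly → Poly → Set
P ∣ₚ Q = ∃ λ (R : Poly) → ∀ n → coeff (P *ₚ R) n ≡ coeff Q n

-1ℤ : ℤ
-1ℤ = -[1+ 0 ]

firstCoeff : Poly → Maybe ℤ
firstCoeff []      = nothing
firstCoeff (a ∷ p) = just a

leadCoeff : Poly → Maybe ℤ
leadCoeff []          = nothing
leadCoeff (a ∷ [])    = just a
leadCoeff (a ∷ b ∷ p) = leadCoeff (b ∷ p)

NonzeroM : Maybe ℤ → Set
NonzeroM nothing  = ⊥
NonzeroM (just a) = a ≢ 0ℤ

IsBorwein : Poly → Set
IsBorwein P = All (λ a → a ≡ -1ℤ ⊎ a ≡ 0ℤ ⊎ a ≡ 1ℤ) P
            × NonzeroM (leadCoeff P) × NonzeroM (firstCoeff P)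

IsLittlewood : Poly → Set
IsLittlewood P = P ≢ [] × All (λ a → a ≡ -1ℤ ⊎ a ≡ 1ℤ) P

nnz : Poly → ℕ
nnz []      = 0
nnz ((+ zero)    ∷ p) = nnz p
nnz ((+ suc _)   ∷ p) = suc (nnz p)
nnz (-[1+ _ ]    ∷ p) = suc (nnz p)

HasNonDividingBorwein : ℕ → Set
HasNonDividingBorwein k =
  ∃ λ (P : Poly) → IsBorwein P × nnz P ≡ k
    × (∀ (Q : Poly) → IsLittlewood Q → (P ∣ₚ Q → ⊥))

-- If P₄ = 1 + X − X³ + X⁴ divides a Littlewood polynomial Q = P₄ R, the coefficients of R obey
-- r_k = q_k − r_{k−1} + r_{k−3} − r_{k−4} with q_k = ±1, so the window (r_{k−1}, …, r_{k−4})
-- walks from the origin back to the origin. The quadratic form V never decreases along a ±1-step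
-- once V > 41 (an explicit sum of squares), and the finitely many windows with V ≤ 41 reachable
-- from the origin never step to the origin; so no such walk exists.
-- Conversely, write a Borwein P with at most three terms as p₀ + X P′. Choose r_k ∈ {−1, 0, 1}
-- greedily so that p₀ r_k + (P′ R)_{k−1} = ±1; as |(P′ R)_{k−1}| ≤ 2 this is possible with
-- r_k ≠ 0 exactly when (P′ R)_{k−1} is even. The parities of r then satisfy a linear recurrence
-- over 𝔽₂ that can be run backwards, so they return to the initial block of zeros, and cutting
-- R there leaves a Littlewood product P R.
module Submission where

open import Defs
open import Data.Bool using (Bool; true; false; not; _∧_; _xor_)
import Data.Bool.Properties as Boolₚ
open import Data.Fin using (Fin; toℕ; fromℕ<; funToFin; finToFun)
open import Data.Fin.Properties using (pigeonhole; 2↔Bool; finToFun-funToFin; toℕ-fromℕ<)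
open import Data.Integer as ℤ using (ℤ; +_; -[1+_]; 0ℤ; 1ℤ; _+_; _*_; _-_; -_; ∣_∣; _<?_)
import Data.Integer.Properties as ℤₚ
open import Data.Integer.Tactic.RingSolver using (solve-∀)
open import Data.List using (List; []; _∷_; map; length; _∷ʳ_; applyUpTo; applyDownFrom; InitLast; initLast; _∷ʳ′_)
import Data.List.Properties as Listₚ
open import Data.List.Relation.Unary.All as All using (All; []; _∷_; all?)
import Data.List.Relation.Unary.All.Properties as Allₚ
open import Data.List.Relation.Unary.Any using (here)
open import Data.Maybe using (just)
open import Data.Nat as ℕ using (ℕ; zero; suc; _≤_; _<_; z≤n; s≤s; _^_; _∸_)
import Data.Nat.Properties as ℕₚ
open import Data.Product using (∃; _×_; _,_; proj₁; proj₂)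
open import Data.Product.Properties using (≡-dec)
open import Data.Sum using (_⊎_; inj₁; inj₂)
open import Function using (_∘_)
open import Function.Bundles using (Inverse)
open import Relation.Binary.Definitions using (DecidableEquality)
open import Relation.Binary.PropositionalEquality
open import Relation.Nullary using (¬_; Dec; yes; no; ¬?; contradiction)
open import Relation.Nullary.Decidable using (toWitness; from-no; _×-dec_; _⊎-dec_)

BorweinCoeff : ℤ → Set
BorweinCoeff x = x ≡ -1ℤ ⊎ x ≡ 0ℤ ⊎ x ≡ 1ℤ

LittlewoodCoeff : ℤ → Set
LittlewoodCoeff x = x ≡ -1ℤ ⊎ x ≡ 1ℤ

coeff-+ₚ : ∀ p q n → coeff (p +ₚ q) n ≡ coeff p n + coeff q n
coeff-+ₚ []      q       n       = sym (ℤₚ.+-identityˡ _)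
coeff-+ₚ (a ∷ p) []      n       = sym (ℤₚ.+-identityʳ _)
coeff-+ₚ (a ∷ p) (b ∷ q) zero    = refl
coeff-+ₚ (a ∷ p) (b ∷ q) (suc n) = coeff-+ₚ p q n

coeff-map-* : ∀ a q n → coeff (map (a *_) q) n ≡ a * coeff q n
coeff-map-* a []      n       = sym (ℤₚ.*-zeroʳ a)
coeff-map-* a (b ∷ q) zero    = refl
coeff-map-* a (b ∷ q) (suc n) = coeff-map-* a q n

coeff-∷-*ₚ : ∀ a p q n → coeff ((a ∷ p) *ₚ q) n ≡ a * coeff q n + coeff (0ℤ ∷ p *ₚ q) n
coeff-∷-*ₚ a p q n = trans (coeff-+ₚ (map (a *_) q) _ n) (cong (_+ _) (coeff-map-* a q n))

coeff-≥length : ∀ p {n} → length p ≤ n → coeff p n ≡ 0ℤ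
coeff-≥length []      _         = refl
coeff-≥length (a ∷ p) (s≤s p≤n) = coeff-≥length p p≤n

coeff-All : ∀ {P : ℤ → Set} {p n} → All P p → n < length p → P (coeff p n)
coeff-All {n = zero}  (pa ∷ _)  _         = pa
coeff-All {n = suc n} (_ ∷ pas) (s≤s n<l) = coeff-All pas n<l

coeff-applyUpTo : ∀ f {T n} → n < T → coeff (applyUpTo f T) n ≡ f n
coeff-applyUpTo f {suc T} {zero}  _         = refl
coeff-applyUpTo f {suc T} {suc n} (s≤s n<T) = coeff-applyUpTo (f ∘ suc) n<T

coeff-applyUpTo-≥ : ∀ f {T n} → T ≤ n → coeff (applyUpTo f T) n ≡ 0ℤ
coeff-applyUpTo-≥ f {T} T≤n =
  coeff-≥length (applyUpTo f T) (subst (_≤ _) (sym (Listₚ.length-applyUpTo f T)) T≤n)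

delay : ℕ → (ℕ → ℤ) → ℕ → ℤ
delay zero    f j       = f j
delay (suc D) f zero    = 0ℤ
delay (suc D) f (suc j) = delay D f j

delay-+ : ∀ D f k → delay D f (D ℕ.+ k) ≡ f k
delay-+ zero    f k = refl
delay-+ (suc D) f k = delay-+ D f k

delay-< : ∀ D f {j} → j < D → delay D f j ≡ 0ℤ
delay-< (suc D) f {zero}  _         = refl
delay-< (suc D) f {suc j} (s≤s j<D) = delay-< D f j<D

delay-cong : ∀ D {f g T} → (∀ {i} → i < T → f i ≡ g i) → ∀ {j} → j < D ℕ.+ T → delay D f j ≡ delay D g j
delay-cong zero    f≡g j<T = f≡g j<T
delay-cong (suc D) f≡g {zero}  _         = refl
delay-cong (suc D) f≡g {suc j} (s≤s j<)  = delay-cong D f≡g j<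

delay-coeff-≥ : ∀ D p {j} → D ℕ.+ length p ≤ j → delay D (coeff p) j ≡ 0ℤ
delay-coeff-≥ zero    p         le       = coeff-≥length p le
delay-coeff-≥ (suc D) p {suc j} (s≤s le) = delay-coeff-≥ D p le

delay-preserves : ∀ (P : ℤ → Set) D {f} → P 0ℤ → (∀ k → P (f k)) → ∀ j → P (delay D f j)
delay-preserves P zero    P0 Pf j       = Pf j
delay-preserves P (suc D) P0 Pf zero    = P0
delay-preserves P (suc D) P0 Pf (suc j) = delay-preserves P D P0 Pf j

applyDownFrom-cong : ∀ {A : Set} {f g : ℕ → A} m → (∀ {j} → j < m → f j ≡ g j) → applyDownFrom f m ≡ applyDownFrom g m
applyDownFrom-cong zero    f≡g = refl
applyDownFrom-cong (suc m) f≡g = cong₂ _∷_ (f≡g ℕₚ.≤-refl) (applyDownFrom-cong m (f≡g ∘ ℕₚ.m<n⇒m<1+n))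

map-applyDownFrom : ∀ {A B : Set} (h : A → B) f m → map h (applyDownFrom f m) ≡ applyDownFrom (h ∘ f) m
map-applyDownFrom h f zero    = refl
map-applyDownFrom h f (suc m) = cong (h (f m) ∷_) (map-applyDownFrom h f m)

dot : List ℤ → List ℤ → ℤ
dot []      w       = 0ℤ
dot (a ∷ p) []      = 0ℤ
dot (a ∷ p) (x ∷ w) = a * x + dot p w

dot-window-≡0 : ∀ p g m → (∀ {j} → m ≤ length p ℕ.+ j → j < m → g j ≡ 0ℤ) → dot p (applyDownFrom g m) ≡ 0ℤ
dot-window-≡0 []      g m       g≡0 = refl
dot-window-≡0 (a ∷ p) g zero    g≡0 = refl
dot-window-≡0 (a ∷ p) g (suc m) g≡0 = begin
  a * g m + dot p (applyDownFrom g m)  ≡⟨ cong₂ (λ x y → a * x + y) (g≡0 (s≤s (ℕₚ.m≤n+m m (length p))) ℕₚ.≤-refl)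
                                                  (dot-window-≡0 p g m (λ le j<m → g≡0 (s≤s le) (ℕₚ.m<n⇒m<1+n j<m))) ⟩
  a * 0ℤ + 0ℤ                          ≡⟨ trans (ℤₚ.+-identityʳ _) (ℤₚ.*-zeroʳ a) ⟩
  0ℤ                                   ∎
  where open ≡-Reasoning

-- Any padding D works: it only appends zeros to the window.
coeff-*ₚ : ∀ D p q n → coeff (p *ₚ q) n ≡ dot p (applyDownFrom (delay D (coeff q)) (suc (D ℕ.+ n)))
coeff-*ₚ D []      q n       = refl
coeff-*ₚ D (a ∷ p) q zero    = begin
  coeff ((a ∷ p) *ₚ q) 0                    ≡⟨ coeff-∷-*ₚ a p q 0 ⟩
  a * coeff q 0 + 0ℤ                        ≡⟨ cong₂ (λ x y → a * x + y) (sym (delay-+ D (coeff q) 0)) (sym window≡0) ⟩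
  a * g (D ℕ.+ 0) + dot p (applyDownFrom g (D ℕ.+ 0)) ∎
  where
  open ≡-Reasoning
  g = delay D (coeff q)
  window≡0 : dot p (applyDownFrom g (D ℕ.+ 0)) ≡ 0ℤ
  window≡0 = dot-window-≡0 p g (D ℕ.+ 0)
    (λ _ j< → delay-< D (coeff q) (subst (_ <_) (ℕₚ.+-identityʳ D) j<))
coeff-*ₚ D (a ∷ p) q (suc n) = begin
  coeff ((a ∷ p) *ₚ q) (suc n)                              ≡⟨ coeff-∷-*ₚ a p q (suc n) ⟩
  a * coeff q (suc n) + coeff (p *ₚ q) n                    ≡⟨ cong₂ (λ x y → a * x + y) (sym (delay-+ D (coeff q) (suc n))) (coeff-*ₚ D p q n) ⟩
  a * g (D ℕ.+ suc n) + dot p (applyDownFrom g (suc (D ℕ.+ n))) ≡⟨ cong (λ m → a * g (D ℕ.+ suc n) + dot p (applyDownFrom g m)) (sym (ℕₚ.+-suc D n)) ⟩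
  a * g (D ℕ.+ suc n) + dot p (applyDownFrom g (D ℕ.+ suc n))   ∎
  where
  open ≡-Reasoning
  g = delay D (coeff q)

P₄ : Poly
P₄ = 1ℤ ∷ 1ℤ ∷ 0ℤ ∷ -1ℤ ∷ 1ℤ ∷ []

State : Set
State = ℤ × ℤ × ℤ × ℤ

_≟ₛ_ : DecidableEquality State
_≟ₛ_ = ≡-dec ℤ._≟_ (≡-dec ℤ._≟_ (≡-dec ℤ._≟_ ℤ._≟_))

open import Data.List.Membership.DecPropositional _≟ₛ_ using (_∈_; _∈?_)

origin : State
origin = 0ℤ , 0ℤ , 0ℤ , 0ℤ

-- If P₄ R = Q then (r_{k-1}, r_{k-2}, r_{k-3}, r_{k-4}) is carried to (r_k, …, r_{k-3}) by step q_k.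
step : ℤ → State → State
step q (a , b , c , d) = q - a + c - d , a , b , c

step-0-reflects-origin : ∀ x → step 0ℤ x ≡ origin → x ≡ origin
step-0-reflects-origin (a , b , c , d) eq
  with cong (proj₁ ∘ proj₂) eq | cong (proj₁ ∘ proj₂ ∘ proj₂) eq | cong (proj₂ ∘ proj₂ ∘ proj₂) eq
... | refl | refl | refl = cong (λ d → 0ℤ , 0ℤ , 0ℤ , d) (sym (ℤₚ.i-j≡0⇒i≡j 0ℤ d (cong proj₁ eq)))

orbit-reaches⇒starts-at : ∀ {A : Set} (F : A → A) {z} → (∀ a → F a ≡ z → a ≡ z) →
                          ∀ (x : ℕ → A) L → (∀ {k} → L ≤ k → x (suc k) ≡ F (x k)) →
                          ∀ n → x (n ℕ.+ L) ≡ z → x L ≡ z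
orbit-reaches⇒starts-at F reflects x L evolves zero    reached = reached
orbit-reaches⇒starts-at F reflects x L evolves (suc n) reached =
  orbit-reaches⇒starts-at F reflects x L evolves n
    (reflects _ (trans (sym (evolves (ℕₚ.m≤n+m L n))) reached))

V : State → ℤ
V (a , b , c , d) = - (b * b) - d * d - + 2 * a * b - + 2 * a * c + + 2 * a * d - + 4 * b * c + + 2 * b * d - + 2 * c * d

dist² : ℤ → State → ℤ
dist² q (a , b , c , d) = (a - q) * (a - q) + (b - q) * (b - q) + (c + q) * (c + q) + d * d

V-step : ∀ q x → V (step q x) ≡ V x + (dist² q x - + 3 * (q * q))
V-step q (a , b , c , d) = expanded q a b c d
  where
  expanded : ∀ q a b c d →
    - (a * a) - c * c - + 2 * (q - a + c - d) * a - + 2 * (q - a + c - d) * b + + 2 * (q - a + c - d) * c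
      - + 4 * a * b + + 2 * a * c - + 2 * b * c
    ≡ (- (b * b) - d * d - + 2 * a * b - + 2 * a * c + + 2 * a * d - + 4 * b * c + + 2 * b * d - + 2 * c * d)
      + ((a - q) * (a - q) + (b - q) * (b - q) + (c + q) * (c + q) + d * d - + 3 * (q * q))
  expanded = solve-∀

0≤sq : ∀ x → 0ℤ ℤ.≤ x * x
0≤sq (+ n)    = subst (0ℤ ℤ.≤_) (ℤₚ.pos-* n n) (ℤ.+≤+ z≤n)
0≤sq -[1+ n ] = ℤ.+≤+ z≤n

0≤+ : ∀ {x y} → 0ℤ ℤ.≤ x → 0ℤ ℤ.≤ y → 0ℤ ℤ.≤ x + y
0≤+ = ℤₚ.+-mono-≤

0≤n* : ∀ n {x} → 0ℤ ℤ.≤ x → 0ℤ ℤ.≤ + n * x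
0≤n* n {x} 0≤x = subst (ℤ._≤ + n * x) (ℤₚ.*-zeroʳ (+ n)) (ℤₚ.*-monoˡ-≤-nonNeg (+ n) 0≤x)

0≤dist² : ∀ q x → 0ℤ ℤ.≤ dist² q x
0≤dist² q (a , b , c , d) = 0≤+ (0≤+ (0≤+ (0≤sq (a - q)) (0≤sq (b - q))) (0≤sq (c + q))) (0≤sq d)

V≤ : ∀ q x → V x ℤ.≤ + 6 * dist² q x + + 18 * (q * q)
V≤ q (a , b , c , d) = ℤₚ.0≤i-j⇒j≤i (0≤231⁻¹ (subst (0ℤ ℤ.≤_) (sym (sos q a b c d)) 0≤sos))
  where
  sos : ∀ q a b c d →
    + 231 * (+ 6 * ((a - q) * (a - q) + (b - q) * (b - q) + (c + q) * (c + q) + d * d) + + 18 * (q * q)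
             - (- (b * b) - d * d - + 2 * a * b - + 2 * a * c + + 2 * a * d - + 4 * b * c + + 2 * b * d - + 2 * c * d))
    ≡ + 693 * ((a - + 2 * q) * (a - + 2 * q) + (b - + 2 * q) * (b - + 2 * q) + (c + + 2 * q) * (c + + 2 * q) + d * d)
      + + 77 * ((+ 3 * a + b + c - d) * (+ 3 * a + b + c - d))
      + + 7 * ((+ 11 * b + + 5 * c - + 2 * d) * (+ 11 * b + + 5 * c - + 2 * d))
      + + 9 * ((+ 7 * c + + 6 * d) * (+ 7 * c + + 6 * d)) + + 495 * (d * d)
  sos = solve-∀
  0≤sos = 0≤+ (0≤+ (0≤+ (0≤+ (0≤n* 693 (0≤dist² (+ 2 * q) (a , b , c , d)))
                              (0≤n* 77 (0≤sq (+ 3 * a + b + c - d))))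
                         (0≤n* 7 (0≤sq (+ 11 * b + + 5 * c - + 2 * d))))
                   (0≤n* 9 (0≤sq (+ 7 * c + + 6 * d))))
              (0≤n* 495 (0≤sq d))
  0≤231⁻¹ : ∀ {y} → 0ℤ ℤ.≤ + 231 * y → 0ℤ ℤ.≤ y
  0≤231⁻¹ {+ _}           _  = ℤ.+≤+ z≤n
  0≤231⁻¹ {y = -[1+ _ ]} ()

sq-littlewood : ∀ {q} → LittlewoodCoeff q → q * q ≡ 1ℤ
sq-littlewood (inj₁ refl) = refl
sq-littlewood (inj₂ refl) = refl

-- A state with V > 41 has dist² ≥ 4, because V ≤ 6 dist² + 18; so V grows along the step.
escape-arith : ∀ {v v′} s → 0ℤ ℤ.≤ s → + 41 ℤ.< v → v ℤ.≤ + 6 * s + + 18 → v′ ≡ v + (s - + 3) → + 41 ℤ.< v′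
escape-arith (+ 0) _ 41<v v≤ _ = contradiction (ℤₚ.<-≤-trans 41<v v≤) (from-no (+ 41 <? + 18))
escape-arith (+ 1) _ 41<v v≤ _ = contradiction (ℤₚ.<-≤-trans 41<v v≤) (from-no (+ 41 <? + 24))
escape-arith (+ 2) _ 41<v v≤ _ = contradiction (ℤₚ.<-≤-trans 41<v v≤) (from-no (+ 41 <? + 30))
escape-arith {v} (+ suc (suc (suc n))) _ 41<v _ refl = ℤₚ.<-≤-trans 41<v (ℤₚ.i≤i+j v (+ n))

V-escapes : ∀ {q} x → LittlewoodCoeff q → + 41 ℤ.< V x → + 41 ℤ.< V (step q x)
V-escapes {q} x q-lit 41<V = escape-arith (dist² q x) (0≤dist² q x) 41<V bound growth
  where
  bound : V x ℤ.≤ + 6 * dist² q x + + 18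
  bound = subst (λ t → V x ℤ.≤ + 6 * dist² q x + + 18 * t) (sq-littlewood q-lit) (V≤ q x)
  growth : V (step q x) ≡ V x + (dist² q x - + 3)
  growth = subst (λ t → V (step q x) ≡ V x + (dist² q x - + 3 * t)) (sq-littlewood q-lit) (V-step q x)

-- The states reachable from the origin by ±1-steps without passing through V > 41.
reachable : List State
reachable =
  (+ 0 , + 0 , + 0 , + 0) ∷
  (+ 1 , + 0 , + 0 , + 0) ∷
  (-[1+ 0 ] , + 0 , + 0 , + 0) ∷
  (+ 0 , + 1 , + 0 , + 0) ∷
  (-[1+ 1 ] , + 1 , + 0 , + 0) ∷
  (+ 2 , -[1+ 0 ] , + 0 , + 0) ∷
  (+ 0 , -[1+ 0 ] , + 0 , + 0) ∷
  (+ 1 , + 0 , + 1 , + 0) ∷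
  (-[1+ 0 ] , + 0 , + 1 , + 0) ∷
  (+ 3 , -[1+ 1 ] , + 1 , + 0) ∷
  (+ 1 , -[1+ 1 ] , + 1 , + 0) ∷
  (-[1+ 0 ] , + 2 , -[1+ 0 ] , + 0) ∷
  (-[1+ 2 ] , + 2 , -[1+ 0 ] , + 0) ∷
  (+ 1 , + 0 , -[1+ 0 ] , + 0) ∷
  (-[1+ 0 ] , + 0 , -[1+ 0 ] , + 0) ∷
  (+ 1 , + 1 , + 0 , + 1) ∷
  (-[1+ 0 ] , + 1 , + 0 , + 1) ∷
  (+ 3 , -[1+ 0 ] , + 0 , + 1) ∷
  (+ 1 , -[1+ 0 ] , + 0 , + 1) ∷
  (-[1+ 0 ] , + 3 , -[1+ 1 ] , + 1) ∷
  (-[1+ 2 ] , + 3 , -[1+ 1 ] , + 1) ∷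
  (+ 1 , + 1 , -[1+ 1 ] , + 1) ∷
  (-[1+ 0 ] , + 1 , -[1+ 1 ] , + 1) ∷
  (+ 1 , -[1+ 0 ] , + 2 , -[1+ 0 ]) ∷
  (-[1+ 0 ] , -[1+ 0 ] , + 2 , -[1+ 0 ]) ∷
  (+ 3 , -[1+ 2 ] , + 2 , -[1+ 0 ]) ∷
  (+ 1 , -[1+ 2 ] , + 2 , -[1+ 0 ]) ∷
  (-[1+ 0 ] , + 1 , + 0 , -[1+ 0 ]) ∷
  (-[1+ 2 ] , + 1 , + 0 , -[1+ 0 ]) ∷
  (+ 1 , -[1+ 0 ] , + 0 , -[1+ 0 ]) ∷
  (-[1+ 0 ] , -[1+ 0 ] , + 0 , -[1+ 0 ]) ∷
  (-[1+ 0 ] , + 1 , + 1 , + 0) ∷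
  (-[1+ 2 ] , + 1 , + 1 , + 0) ∷
  (+ 1 , -[1+ 0 ] , + 1 , + 0) ∷
  (-[1+ 0 ] , -[1+ 0 ] , + 1 , + 0) ∷
  (-[1+ 2 ] , + 3 , -[1+ 0 ] , + 0) ∷
  (-[1+ 4 ] , + 3 , -[1+ 0 ] , + 0) ∷
  (-[1+ 0 ] , + 1 , -[1+ 0 ] , + 0) ∷
  (-[1+ 2 ] , + 1 , -[1+ 0 ] , + 0) ∷
  (-[1+ 0 ] , -[1+ 0 ] , + 3 , -[1+ 1 ]) ∷
  (-[1+ 2 ] , + 1 , + 1 , -[1+ 1 ]) ∷
  (-[1+ 4 ] , + 1 , + 1 , -[1+ 1 ]) ∷
  (-[1+ 0 ] , -[1+ 0 ] , + 1 , -[1+ 1 ]) ∷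
  (-[1+ 2 ] , -[1+ 0 ] , + 1 , -[1+ 1 ]) ∷
  (+ 3 , + 1 , -[1+ 0 ] , + 2) ∷
  (+ 1 , + 1 , -[1+ 0 ] , + 2) ∷
  (+ 5 , -[1+ 0 ] , -[1+ 0 ] , + 2) ∷
  (+ 3 , -[1+ 0 ] , -[1+ 0 ] , + 2) ∷
  (+ 1 , + 1 , -[1+ 2 ] , + 2) ∷
  (+ 3 , -[1+ 0 ] , + 1 , + 0) ∷
  (+ 5 , -[1+ 2 ] , + 1 , + 0) ∷
  (+ 3 , -[1+ 2 ] , + 1 , + 0) ∷
  (+ 1 , + 1 , -[1+ 0 ] , + 0) ∷
  (+ 3 , -[1+ 0 ] , -[1+ 0 ] , + 0) ∷
  (+ 1 , -[1+ 0 ] , -[1+ 0 ] , + 0) ∷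
  (+ 3 , -[1+ 0 ] , + 1 , + 1) ∷
  (+ 1 , -[1+ 0 ] , + 1 , + 1) ∷
  (+ 5 , -[1+ 2 ] , + 1 , + 1) ∷
  (+ 3 , -[1+ 2 ] , + 1 , + 1) ∷
  (+ 1 , + 1 , -[1+ 0 ] , + 1) ∷
  (-[1+ 0 ] , + 1 , -[1+ 0 ] , + 1) ∷
  (+ 3 , -[1+ 0 ] , -[1+ 0 ] , + 1) ∷
  (+ 1 , -[1+ 0 ] , -[1+ 0 ] , + 1) ∷
  (+ 3 , -[1+ 2 ] , + 3 , -[1+ 0 ]) ∷
  (+ 1 , -[1+ 2 ] , + 3 , -[1+ 0 ]) ∷
  (+ 1 , -[1+ 0 ] , + 1 , -[1+ 0 ]) ∷
  (-[1+ 0 ] , -[1+ 0 ] , + 1 , -[1+ 0 ]) ∷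
  (+ 3 , -[1+ 2 ] , + 1 , -[1+ 0 ]) ∷
  (+ 1 , -[1+ 2 ] , + 1 , -[1+ 0 ]) ∷
  (+ 5 , -[1+ 0 ] , -[1+ 0 ] , + 3) ∷
  (+ 7 , -[1+ 2 ] , + 1 , + 1) ∷
  (+ 5 , -[1+ 0 ] , -[1+ 0 ] , + 1) ∷
  (+ 5 , -[1+ 2 ] , -[1+ 0 ] , + 1) ∷
  (-[1+ 4 ] , + 3 , + 1 , -[1+ 0 ]) ∷
  (-[1+ 2 ] , + 1 , + 1 , -[1+ 0 ]) ∷
  (-[1+ 4 ] , + 1 , + 1 , -[1+ 0 ]) ∷
  (-[1+ 4 ] , + 3 , -[1+ 0 ] , -[1+ 0 ]) ∷
  (-[1+ 6 ] , + 3 , -[1+ 0 ] , -[1+ 0 ]) ∷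
  (-[1+ 4 ] , + 1 , + 1 , -[1+ 2 ]) ∷
  (-[1+ 0 ] , + 3 , -[1+ 0 ] , + 1) ∷
  (-[1+ 2 ] , + 3 , -[1+ 0 ] , + 1) ∷
  (-[1+ 0 ] , + 3 , -[1+ 2 ] , + 1) ∷
  (-[1+ 2 ] , + 3 , -[1+ 2 ] , + 1) ∷
  (-[1+ 0 ] , + 1 , + 1 , -[1+ 0 ]) ∷
  (-[1+ 2 ] , + 3 , -[1+ 0 ] , -[1+ 0 ]) ∷
  (-[1+ 0 ] , + 1 , -[1+ 0 ] , -[1+ 0 ]) ∷
  (-[1+ 2 ] , + 1 , -[1+ 0 ] , -[1+ 0 ]) ∷
  (-[1+ 1 ] , + 3 , -[1+ 0 ] , + 1) ∷
  (-[1+ 3 ] , + 3 , -[1+ 0 ] , + 1) ∷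
  (+ 0 , + 1 , -[1+ 0 ] , + 1) ∷
  (-[1+ 1 ] , + 1 , -[1+ 0 ] , + 1) ∷
  (-[1+ 1 ] , + 3 , -[1+ 2 ] , + 1) ∷
  (-[1+ 3 ] , + 3 , -[1+ 2 ] , + 1) ∷
  (-[1+ 1 ] , + 1 , + 1 , -[1+ 0 ]) ∷
  (-[1+ 3 ] , + 1 , + 1 , -[1+ 0 ]) ∷
  (+ 0 , -[1+ 0 ] , + 1 , -[1+ 0 ]) ∷
  (-[1+ 1 ] , -[1+ 0 ] , + 1 , -[1+ 0 ]) ∷
  (-[1+ 3 ] , + 3 , -[1+ 0 ] , -[1+ 0 ]) ∷
  (-[1+ 5 ] , + 3 , -[1+ 0 ] , -[1+ 0 ]) ∷
  (-[1+ 1 ] , + 1 , -[1+ 0 ] , -[1+ 0 ]) ∷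
  (-[1+ 3 ] , + 1 , -[1+ 0 ] , -[1+ 0 ]) ∷
  (+ 2 , + 1 , -[1+ 0 ] , + 1) ∷
  (+ 4 , -[1+ 0 ] , -[1+ 0 ] , + 1) ∷
  (+ 2 , -[1+ 0 ] , -[1+ 0 ] , + 1) ∷
  (+ 0 , + 3 , -[1+ 2 ] , + 1) ∷
  (+ 2 , + 1 , -[1+ 2 ] , + 1) ∷
  (+ 0 , + 1 , -[1+ 2 ] , + 1) ∷
  (+ 6 , -[1+ 2 ] , + 1 , + 1) ∷
  (+ 4 , -[1+ 2 ] , + 1 , + 1) ∷
  (+ 0 , -[1+ 0 ] , + 3 , -[1+ 0 ]) ∷
  (-[1+ 1 ] , -[1+ 0 ] , + 3 , -[1+ 0 ]) ∷
  (+ 2 , -[1+ 2 ] , + 3 , -[1+ 0 ]) ∷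
  (+ 0 , -[1+ 2 ] , + 3 , -[1+ 0 ]) ∷
  (+ 4 , -[1+ 0 ] , + 1 , + 1) ∷
  (+ 2 , -[1+ 0 ] , + 1 , + 1) ∷
  (+ 4 , -[1+ 2 ] , + 3 , -[1+ 0 ]) ∷
  (+ 2 , -[1+ 0 ] , + 1 , -[1+ 0 ]) ∷
  (+ 4 , -[1+ 2 ] , + 1 , -[1+ 0 ]) ∷
  (+ 2 , -[1+ 2 ] , + 1 , -[1+ 0 ]) ∷
  (+ 1 , -[1+ 1 ] , + 3 , -[1+ 0 ]) ∷
  (-[1+ 0 ] , -[1+ 1 ] , + 3 , -[1+ 0 ]) ∷
  (-[1+ 0 ] , + 0 , + 1 , -[1+ 0 ]) ∷
  (-[1+ 2 ] , + 0 , + 1 , -[1+ 0 ]) ∷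
  (+ 1 , -[1+ 1 ] , + 1 , -[1+ 0 ]) ∷
  (-[1+ 0 ] , -[1+ 1 ] , + 1 , -[1+ 0 ]) ∷
  (+ 5 , -[1+ 1 ] , + 1 , + 1) ∷
  (+ 3 , -[1+ 1 ] , + 1 , + 1) ∷
  (+ 5 , -[1+ 3 ] , + 1 , + 1) ∷
  (+ 3 , + 0 , -[1+ 0 ] , + 1) ∷
  (+ 1 , + 0 , -[1+ 0 ] , + 1) ∷
  (+ 5 , -[1+ 1 ] , -[1+ 0 ] , + 1) ∷
  (+ 3 , -[1+ 1 ] , -[1+ 0 ] , + 1) ∷
  (+ 3 , -[1+ 1 ] , + 1 , -[1+ 0 ]) ∷
  (+ 5 , -[1+ 3 ] , + 1 , -[1+ 0 ]) ∷
  (+ 3 , -[1+ 3 ] , + 1 , -[1+ 0 ]) ∷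
  (-[1+ 2 ] , + 2 , + 1 , -[1+ 0 ]) ∷
  (-[1+ 4 ] , + 2 , + 1 , -[1+ 0 ]) ∷
  (-[1+ 4 ] , + 4 , -[1+ 0 ] , -[1+ 0 ]) ∷
  (-[1+ 2 ] , + 2 , -[1+ 0 ] , -[1+ 0 ]) ∷
  (-[1+ 4 ] , + 2 , -[1+ 0 ] , -[1+ 0 ]) ∷
  (-[1+ 4 ] , + 2 , + 1 , -[1+ 2 ]) ∷
  (-[1+ 2 ] , + 0 , + 1 , -[1+ 2 ]) ∷
  (-[1+ 4 ] , + 0 , + 1 , -[1+ 2 ]) ∷
  (+ 5 , + 0 , -[1+ 0 ] , + 3) ∷
  (+ 3 , + 0 , -[1+ 0 ] , + 3) ∷
  (+ 5 , -[1+ 1 ] , -[1+ 0 ] , + 3) ∷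
  (-[1+ 2 ] , + 4 , -[1+ 0 ] , + 1) ∷
  (-[1+ 4 ] , + 4 , -[1+ 0 ] , + 1) ∷
  (-[1+ 0 ] , + 2 , -[1+ 0 ] , + 1) ∷
  (-[1+ 2 ] , + 2 , -[1+ 0 ] , + 1) ∷
  (+ 1 , + 2 , -[1+ 0 ] , + 1) ∷
  (+ 1 , + 2 , -[1+ 2 ] , + 1) ∷
  (-[1+ 0 ] , + 2 , -[1+ 2 ] , + 1) ∷
  (+ 2 , + 1 , -[1+ 1 ] , + 3) ∷
  (+ 4 , -[1+ 0 ] , -[1+ 1 ] , + 3) ∷
  (+ 4 , -[1+ 0 ] , + 0 , + 1) ∷
  (+ 2 , -[1+ 0 ] , + 0 , + 1) ∷
  (+ 6 , -[1+ 2 ] , + 0 , + 1) ∷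
  (+ 4 , -[1+ 2 ] , + 0 , + 1) ∷
  (+ 2 , + 1 , -[1+ 1 ] , + 1) ∷
  (+ 0 , + 1 , -[1+ 1 ] , + 1) ∷
  (+ 4 , -[1+ 0 ] , -[1+ 1 ] , + 1) ∷
  (+ 2 , -[1+ 0 ] , -[1+ 1 ] , + 1) ∷
  (-[1+ 1 ] , + 3 , -[1+ 1 ] , + 1) ∷
  (-[1+ 3 ] , + 3 , -[1+ 1 ] , + 1) ∷
  (-[1+ 3 ] , + 3 , + 0 , -[1+ 0 ]) ∷
  (-[1+ 5 ] , + 3 , + 0 , -[1+ 0 ]) ∷
  (-[1+ 1 ] , + 1 , + 0 , -[1+ 0 ]) ∷
  (-[1+ 3 ] , + 1 , + 0 , -[1+ 0 ]) ∷
  (-[1+ 3 ] , + 3 , -[1+ 1 ] , -[1+ 0 ]) ∷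
  (-[1+ 5 ] , + 3 , -[1+ 1 ] , -[1+ 0 ]) ∷
  (+ 0 , + 3 , -[1+ 1 ] , + 1) ∷
  (+ 6 , -[1+ 2 ] , + 2 , + 1) ∷
  (+ 4 , -[1+ 2 ] , + 2 , + 1) ∷
  (+ 4 , -[1+ 2 ] , + 2 , -[1+ 0 ]) ∷
  (+ 2 , -[1+ 2 ] , + 2 , -[1+ 0 ]) ∷
  (+ 0 , -[1+ 0 ] , + 2 , -[1+ 0 ]) ∷
  (-[1+ 1 ] , -[1+ 0 ] , + 2 , -[1+ 0 ]) ∷
  (+ 0 , -[1+ 2 ] , + 2 , -[1+ 0 ]) ∷
  (-[1+ 1 ] , + 1 , + 2 , -[1+ 0 ]) ∷
  (-[1+ 3 ] , + 1 , + 2 , -[1+ 0 ]) ∷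
  (-[1+ 3 ] , + 1 , + 2 , -[1+ 2 ]) ∷
  (-[1+ 1 ] , -[1+ 0 ] , + 2 , -[1+ 2 ]) ∷
  (-[1+ 5 ] , + 2 , + 1 , -[1+ 1 ]) ∷
  (-[1+ 3 ] , + 4 , -[1+ 0 ] , + 0) ∷
  (-[1+ 5 ] , + 4 , -[1+ 0 ] , + 0) ∷
  (-[1+ 1 ] , + 2 , -[1+ 0 ] , + 0) ∷
  (-[1+ 3 ] , + 2 , -[1+ 0 ] , + 0) ∷
  (-[1+ 3 ] , + 4 , -[1+ 2 ] , + 0) ∷
  (-[1+ 3 ] , + 2 , + 1 , -[1+ 1 ]) ∷
  (-[1+ 1 ] , + 0 , + 1 , -[1+ 1 ]) ∷
  (-[1+ 3 ] , + 0 , + 1 , -[1+ 1 ]) ∷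
  (-[1+ 5 ] , + 4 , -[1+ 0 ] , -[1+ 1 ]) ∷
  (-[1+ 3 ] , + 2 , -[1+ 0 ] , -[1+ 1 ]) ∷
  (-[1+ 5 ] , + 2 , -[1+ 0 ] , -[1+ 1 ]) ∷
  (+ 0 , -[1+ 1 ] , + 3 , -[1+ 1 ]) ∷
  (+ 4 , -[1+ 3 ] , + 3 , + 0) ∷
  (+ 4 , -[1+ 1 ] , + 1 , + 0) ∷
  (+ 2 , -[1+ 1 ] , + 1 , + 0) ∷
  (+ 6 , -[1+ 3 ] , + 1 , + 0) ∷
  (+ 4 , -[1+ 3 ] , + 1 , + 0) ∷
  (-[1+ 1 ] , + 0 , + 3 , -[1+ 1 ]) ∷
  (+ 0 , + 2 , -[1+ 2 ] , + 2) ∷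
  (+ 4 , + 0 , -[1+ 0 ] , + 2) ∷
  (+ 2 , + 0 , -[1+ 0 ] , + 2) ∷
  (+ 6 , -[1+ 1 ] , -[1+ 0 ] , + 2) ∷
  (+ 4 , -[1+ 1 ] , -[1+ 0 ] , + 2) ∷
  (+ 2 , + 0 , -[1+ 2 ] , + 2) ∷
  (+ 6 , -[1+ 1 ] , + 1 , + 2) ∷
  (+ 4 , -[1+ 1 ] , + 1 , + 2) ∷
  (+ 6 , -[1+ 3 ] , + 1 , + 2) ∷
  (+ 2 , -[1+ 1 ] , + 2 , -[1+ 0 ]) ∷
  (+ 0 , -[1+ 1 ] , + 2 , -[1+ 0 ]) ∷
  (+ 4 , -[1+ 3 ] , + 2 , -[1+ 0 ]) ∷
  (+ 2 , -[1+ 3 ] , + 2 , -[1+ 0 ]) ∷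
  (+ 6 , -[1+ 3 ] , + 2 , + 1) ∷
  (+ 6 , -[1+ 1 ] , + 0 , + 1) ∷
  (+ 4 , -[1+ 1 ] , + 0 , + 1) ∷
  (+ 6 , -[1+ 3 ] , + 0 , + 1) ∷
  (+ 6 , -[1+ 3 ] , + 2 , -[1+ 0 ]) ∷
  (-[1+ 1 ] , + 4 , -[1+ 1 ] , + 1) ∷
  (-[1+ 3 ] , + 4 , -[1+ 1 ] , + 1) ∷
  (+ 0 , + 2 , -[1+ 1 ] , + 1) ∷
  (-[1+ 1 ] , + 2 , -[1+ 1 ] , + 1) ∷
  (+ 6 , -[1+ 1 ] , + 0 , + 3) ∷
  (-[1+ 5 ] , + 4 , + 0 , -[1+ 0 ]) ∷
  (-[1+ 3 ] , + 2 , + 0 , -[1+ 0 ]) ∷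
  (-[1+ 5 ] , + 2 , + 0 , -[1+ 0 ]) ∷
  (-[1+ 5 ] , + 4 , -[1+ 1 ] , -[1+ 0 ]) ∷
  (-[1+ 5 ] , + 2 , + 0 , -[1+ 2 ]) ∷
  (-[1+ 5 ] , + 4 , -[1+ 1 ] , + 1) ∷
  (+ 2 , + 2 , -[1+ 1 ] , + 2) ∷
  (+ 0 , + 2 , -[1+ 1 ] , + 2) ∷
  (+ 4 , + 0 , -[1+ 1 ] , + 2) ∷
  (+ 2 , + 0 , -[1+ 1 ] , + 2) ∷
  (-[1+ 3 ] , + 4 , -[1+ 1 ] , + 0) ∷
  (-[1+ 5 ] , + 4 , -[1+ 1 ] , + 0) ∷
  (-[1+ 1 ] , + 0 , + 2 , -[1+ 1 ]) ∷
  (-[1+ 3 ] , + 0 , + 2 , -[1+ 1 ]) ∷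
  (+ 0 , -[1+ 1 ] , + 2 , -[1+ 1 ]) ∷
  (-[1+ 1 ] , -[1+ 1 ] , + 2 , -[1+ 1 ]) ∷
  (+ 6 , -[1+ 3 ] , + 2 , + 0) ∷
  (+ 4 , -[1+ 3 ] , + 2 , + 0) ∷
  (-[1+ 4 ] , + 2 , + 2 , -[1+ 1 ]) ∷
  (-[1+ 2 ] , + 0 , + 2 , -[1+ 1 ]) ∷
  (-[1+ 4 ] , + 2 , + 0 , -[1+ 1 ]) ∷
  (-[1+ 6 ] , + 2 , + 0 , -[1+ 1 ]) ∷
  (+ 7 , -[1+ 1 ] , + 0 , + 2) ∷
  (+ 5 , -[1+ 1 ] , + 0 , + 2) ∷
  (+ 3 , + 0 , -[1+ 1 ] , + 2) ∷
  (+ 5 , -[1+ 1 ] , -[1+ 1 ] , + 2) ∷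
  (+ 6 , -[1+ 2 ] , + 0 , + 2) ∷
  (-[1+ 5 ] , + 3 , + 0 , -[1+ 1 ]) ∷
  []

Good : State → Set
Good x = x ∈ reachable ⊎ + 41 ℤ.< V x

SafeStep : ℤ → State → Set
SafeStep q x = step q x ≢ origin × Good (step q x)

reachable-closed : All (λ x → SafeStep -1ℤ x × SafeStep 1ℤ x) reachable
reachable-closed = toWitness {a? = all? (λ x → safe? -1ℤ x ×-dec safe? 1ℤ x) reachable} _
  where
  safe? : ∀ q x → Dec (SafeStep q x)
  safe? q x = ¬? (step q x ≟ₛ origin) ×-dec ((step q x ∈? reachable) ⊎-dec (+ 41 <? V (step q x)))

good-step : ∀ {q x} → LittlewoodCoeff q → Good x → SafeStep q x
good-step (inj₁ refl) (inj₁ x∈) = proj₁ (All.lookup reachable-closed x∈)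
good-step (inj₂ refl) (inj₁ x∈) = proj₂ (All.lookup reachable-closed x∈)
good-step {q} {x} q-lit (inj₂ 41<V) =
  (λ at-origin → 41≮V-origin (subst (λ y → + 41 ℤ.< V y) at-origin 41<V′)) , inj₂ 41<V′
  where
  41<V′ = V-escapes x q-lit 41<V
  41≮V-origin = from-no (+ 41 <? V origin)

module P₄-Cofactor (R Q : Poly) (P₄R≡Q : ∀ n → coeff (P₄ *ₚ R) n ≡ coeff Q n) where

  r : ℕ → ℤ
  r = delay 4 (coeff R)

  state : ℕ → State
  state k = r (3 ℕ.+ k) , r (2 ℕ.+ k) , r (1 ℕ.+ k) , r k

  state-suc : ∀ k → state (suc k) ≡ step (coeff Q k) (state k)
  state-suc k = cong (λ x → x , r (3 ℕ.+ k) , r (2 ℕ.+ k) , r (1 ℕ.+ k)) recurrence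
    where
    -- The right-hand side is dot P₄ (applyDownFrom r (5 + k)) unfolded.
    isolate : ∀ a b c d e → a ≡ (1ℤ * a + (1ℤ * b + (0ℤ * c + (-1ℤ * d + (1ℤ * e + 0ℤ))))) - b + d - e
    isolate = solve-∀
    recurrence : r (4 ℕ.+ k) ≡ coeff Q k - r (3 ℕ.+ k) + r (1 ℕ.+ k) - r k
    recurrence = trans (isolate (r (4 ℕ.+ k)) (r (3 ℕ.+ k)) (r (2 ℕ.+ k)) (r (1 ℕ.+ k)) (r k))
      (cong (λ t → t - r (3 ℕ.+ k) + r (1 ℕ.+ k) - r k) (trans (sym (coeff-*ₚ 4 P₄ R k)) (P₄R≡Q k)))

  state-vanishes : ∀ {k} → 4 ℕ.+ length R ≤ k → state k ≡ origin
  state-vanishes le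
    rewrite delay-coeff-≥ 4 R (ℕₚ.m≤n⇒m≤o+n 3 le) | delay-coeff-≥ 4 R (ℕₚ.m≤n⇒m≤o+n 2 le)
          | delay-coeff-≥ 4 R (ℕₚ.m≤n⇒m≤o+n 1 le) | delay-coeff-≥ 4 R le = refl

P₄∤Littlewood : ∀ Q → IsLittlewood Q → ¬ (P₄ ∣ₚ Q)
P₄∤Littlewood []          (Q≢[] , _)     _ = Q≢[] refl
P₄∤Littlewood Q@(_ ∷ Q′) (_ , Q-lit) (R , P₄R≡Q) = proj₁ (good-step q-lit (good L′ ℕₚ.≤-refl)) returns
  where
  open P₄-Cofactor R Q P₄R≡Q
  L′ = length Q′
  q-lit = coeff-All Q-lit (ℕₚ.n<1+n L′)

  good : ∀ k → k ≤ length Q′ → Good (state k)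
  good zero    _    = inj₁ (here refl)
  good (suc k) k<L′ = subst Good (sym (state-suc k))
    (proj₂ (good-step (coeff-All Q-lit (s≤s (ℕₚ.<⇒≤ k<L′))) (good k (ℕₚ.<⇒≤ k<L′))))

  ends-at-origin : state (length Q) ≡ origin
  ends-at-origin = orbit-reaches⇒starts-at (step 0ℤ) step-0-reflects-origin state (length Q)
    (λ {k} L≤k → trans (state-suc k) (cong (λ q → step q (state k)) (coeff-≥length Q L≤k)))
    (4 ℕ.+ length R) (state-vanishes (ℕₚ.m≤m+n _ _))

  returns : step (coeff Q L′) (state L′) ≡ origin
  returns = trans (sym (state-suc L′)) ends-at-origin

oddℕ : ℕ → Bool
oddℕ zero    = false
oddℕ (suc n) = not (oddℕ n)

odd : ℤ → Bool
odd (+ n)    = oddℕ n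
odd -[1+ n ] = not (oddℕ n)

odd-+ : ∀ {v} y → BorweinCoeff v → odd (v + y) ≡ odd v xor odd y
odd-+ (+ zero)     (inj₁ refl)        = refl
odd-+ (+ suc n)    (inj₁ refl)        = sym (Boolₚ.not-involutive (oddℕ n))
odd-+ -[1+ n ]     (inj₁ refl)        = refl
odd-+ y            (inj₂ (inj₁ refl)) = cong odd (ℤₚ.+-identityˡ y)
odd-+ (+ n)        (inj₂ (inj₂ refl)) = refl
odd-+ -[1+ zero ]  (inj₂ (inj₂ refl)) = refl
odd-+ -[1+ suc n ] (inj₂ (inj₂ refl)) = sym (Boolₚ.not-involutive (not (oddℕ n)))

*-borwein : ∀ {a b} → BorweinCoeff a → BorweinCoeff b → BorweinCoeff (a * b) × odd (a * b) ≡ odd a ∧ odd b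
*-borwein (inj₁ refl)        (inj₁ refl)        = inj₂ (inj₂ refl) , refl
*-borwein (inj₁ refl)        (inj₂ (inj₁ refl)) = inj₂ (inj₁ refl) , refl
*-borwein (inj₁ refl)        (inj₂ (inj₂ refl)) = inj₁ refl , refl
*-borwein (inj₂ (inj₁ refl)) (inj₁ refl)        = inj₂ (inj₁ refl) , refl
*-borwein (inj₂ (inj₁ refl)) (inj₂ (inj₁ refl)) = inj₂ (inj₁ refl) , refl
*-borwein (inj₂ (inj₁ refl)) (inj₂ (inj₂ refl)) = inj₂ (inj₁ refl) , refl
*-borwein (inj₂ (inj₂ refl)) (inj₁ refl)        = inj₁ refl , refl
*-borwein (inj₂ (inj₂ refl)) (inj₂ (inj₁ refl)) = inj₂ (inj₁ refl) , refl
*-borwein (inj₂ (inj₂ refl)) (inj₂ (inj₂ refl)) = inj₂ (inj₂ refl) , refl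

∣borwein∣≤1 : ∀ {x} → BorweinCoeff x → ∣ x ∣ ≤ 1
∣borwein∣≤1 (inj₁ refl)        = s≤s z≤n
∣borwein∣≤1 (inj₂ (inj₁ refl)) = z≤n
∣borwein∣≤1 (inj₂ (inj₂ refl)) = s≤s z≤n

odd≡false⇒0 : ∀ {x} → BorweinCoeff x → odd x ≡ false → x ≡ 0ℤ
odd≡false⇒0 (inj₂ (inj₁ refl)) _ = refl
odd≡false⇒0 (inj₁ refl)        ()
odd≡false⇒0 (inj₂ (inj₂ refl)) ()

littlewood⇒borwein : ∀ {x} → LittlewoodCoeff x → BorweinCoeff x
littlewood⇒borwein (inj₁ refl) = inj₁ refl
littlewood⇒borwein (inj₂ refl) = inj₂ (inj₂ refl)

borwein-nonzero⇒littlewood : ∀ {x} → BorweinCoeff x → x ≢ 0ℤ → LittlewoodCoeff x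
borwein-nonzero⇒littlewood (inj₁ refl)        _   = inj₁ refl
borwein-nonzero⇒littlewood (inj₂ (inj₁ refl)) x≢0 = contradiction refl x≢0
borwein-nonzero⇒littlewood (inj₂ (inj₂ refl)) _   = inj₂ refl

odd-littlewood : ∀ {x} → LittlewoodCoeff x → odd x ≡ true
odd-littlewood (inj₁ refl) = refl
odd-littlewood (inj₂ refl) = refl

∣a*x+t∣≤1+ : ∀ {a x t n} → BorweinCoeff a → BorweinCoeff x → ∣ t ∣ ≤ n → ∣ a * x + t ∣ ≤ suc n
∣a*x+t∣≤1+ {a} {x} {t} a∈ x∈ t≤n =
  ℕₚ.≤-trans (ℤₚ.∣i+j∣≤∣i∣+∣j∣ (a * x) t) (ℕₚ.+-mono-≤ (∣borwein∣≤1 (proj₁ (*-borwein a∈ x∈))) t≤n)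

∣dot∣≤nnz : ∀ {p w} → All BorweinCoeff p → All BorweinCoeff w → ∣ dot p w ∣ ≤ nnz p
∣dot∣≤nnz []       _  = z≤n
∣dot∣≤nnz (_ ∷ _)  [] = z≤n
∣dot∣≤nnz {_ ∷ p} {x ∷ w} (inj₂ (inj₁ refl) ∷ bp) (_ ∷ bw) rewrite ℤₚ.+-identityˡ (dot p w) = ∣dot∣≤nnz bp bw
∣dot∣≤nnz (inj₁ refl        ∷ bp) (x∈ ∷ bw) = ∣a*x+t∣≤1+ (inj₁ refl) x∈ (∣dot∣≤nnz bp bw)
∣dot∣≤nnz (inj₂ (inj₂ refl) ∷ bp) (x∈ ∷ bw) = ∣a*x+t∣≤1+ (inj₂ (inj₂ refl)) x∈ (∣dot∣≤nnz bp bw)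

dot₂ : List ℤ → List Bool → Bool
dot₂ []      w       = false
dot₂ (a ∷ p) []      = false
dot₂ (a ∷ p) (x ∷ w) = (odd a ∧ x) xor dot₂ p w

odd-dot : ∀ {p w} → All BorweinCoeff p → All BorweinCoeff w → odd (dot p w) ≡ dot₂ p (map odd w)
odd-dot []       _  = refl
odd-dot (_ ∷ _)  [] = refl
odd-dot {a ∷ p} {x ∷ w} (a∈ ∷ bp) (x∈ ∷ bw) = begin
  odd (a * x + dot p w)               ≡⟨ odd-+ (dot p w) (proj₁ (*-borwein a∈ x∈)) ⟩
  odd (a * x) xor odd (dot p w)       ≡⟨ cong₂ _xor_ (proj₂ (*-borwein a∈ x∈)) (odd-dot bp bw) ⟩
  (odd a ∧ odd x) xor dot₂ p (map odd w) ∎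
  where open ≡-Reasoning

dot₂-∷ʳ : ∀ u c S k → dot₂ (u ∷ʳ c) (applyDownFrom S (length u ℕ.+ suc k))
                     ≡ dot₂ u (applyDownFrom S (length u ℕ.+ suc k)) xor (odd c ∧ S k)
dot₂-∷ʳ []      c S k = Boolₚ.xor-identityʳ (odd c ∧ S k)
dot₂-∷ʳ (b ∷ u) c S k = trans (cong ((odd b ∧ S (length u ℕ.+ suc k)) xor_) (dot₂-∷ʳ u c S k))
                              (sym (Boolₚ.xor-assoc (odd b ∧ S (length u ℕ.+ suc k)) _ _))

dot₂-window-cong : ∀ u S {k k′} → (∀ {i} → i < length u → S (k ℕ.+ i) ≡ S (k′ ℕ.+ i)) →
                   dot₂ u (applyDownFrom S (length u ℕ.+ k)) ≡ dot₂ u (applyDownFrom S (length u ℕ.+ k′))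
dot₂-window-cong []      S same = refl
dot₂-window-cong (b ∷ u) S {k} {k′} same = cong₂ (λ x y → (odd b ∧ x) xor y)
  (subst₂ (λ i j → S i ≡ S j) (ℕₚ.+-comm k (length u)) (ℕₚ.+-comm k′ (length u)) (same ℕₚ.≤-refl))
  (dot₂-window-cong u S (same ∘ ℕₚ.m<n⇒m<1+n))

not-xor-cancelˡ : ∀ x y z → not (x xor y) ≡ not (x xor z) → y ≡ z
not-xor-cancelˡ x     false false _ = refl
not-xor-cancelˡ x     true  true  _ = refl
not-xor-cancelˡ false false true  ()
not-xor-cancelˡ false true  false ()
not-xor-cancelˡ true  false true  ()
not-xor-cancelˡ true  true  false ()

SameWindow : (ℕ → Bool) → ℕ → ℕ → ℕ → Set
SameWindow S d k k′ = ∀ {i} → i < d → S (k ℕ.+ i) ≡ S (k′ ℕ.+ i)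

windowCode : (ℕ → Bool) → (d k : ℕ) → Fin (2 ^ d)
windowCode S d k = funToFin (λ (i : Fin d) → Inverse.from 2↔Bool (S (k ℕ.+ toℕ i)))

windowCode-injective : ∀ S d {k k′} → windowCode S d k ≡ windowCode S d k′ → SameWindow S d k k′
windowCode-injective S d {k} {k′} same {i} i<d =
  subst (λ m → S (k ℕ.+ m) ≡ S (k′ ℕ.+ m)) (toℕ-fromℕ< i<d) (from-injective (begin
    from (S (k ℕ.+ toℕ j))                 ≡⟨ sym (finToFun-funToFin (code k) j) ⟩
    finToFun {2} {d} (windowCode S d k) j  ≡⟨ cong (λ c → finToFun c j) same ⟩
    finToFun {2} {d} (windowCode S d k′) j ≡⟨ finToFun-funToFin (code k′) j ⟩
    from (S (k′ ℕ.+ toℕ j))                ∎))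
  where
  open ≡-Reasoning
  open Inverse 2↔Bool using (to; from; strictlyInverseˡ)
  j = fromℕ< i<d
  code : ℕ → Fin d → Fin 2
  code m i = from (S (m ℕ.+ toℕ i))
  from-injective : ∀ {x y} → from x ≡ from y → x ≡ y
  from-injective {x} {y} eq = trans (sym (strictlyInverseˡ x)) (trans (cong to eq) (strictlyInverseˡ y))

window-returns : ∀ S d → (∀ {k k′} → SameWindow S d (suc k) (suc k′) → SameWindow S d k k′) →
                 ∃ λ t → 0 < t × SameWindow S d 0 t
window-returns S d backward with pigeonhole (ℕₚ.n<1+n (2 ^ d)) (windowCode S d ∘ toℕ)
... | i , j , i<j , same = toℕ j ∸ toℕ i , ℕₚ.m<n⇒0<n∸m i<j , rewind (toℕ i)
  (subst (SameWindow S d (toℕ i)) (sym (ℕₚ.m+[n∸m]≡n (ℕₚ.<⇒≤ i<j))) (windowCode-injective S d same))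
  where
  rewind : ∀ k {t} → SameWindow S d k (k ℕ.+ t) → SameWindow S d 0 t
  rewind zero    same = same
  rewind (suc k) same = rewind k (backward same)

correction : ℤ → ℤ → ℤ
correction p₀ (+ 0)     = p₀
correction p₀ (+ 2)     = - p₀
correction p₀ -[1+ 1 ]  = p₀
correction p₀ _         = 0ℤ

record Corrects (p₀ t c : ℤ) : Set where
  constructor corrects
  field
    sum-littlewood : LittlewoodCoeff (p₀ * c + t)
    borwein        : BorweinCoeff c
    odd-flips      : odd c ≡ not (odd t)

correction-corrects : ∀ {p₀ t} → LittlewoodCoeff p₀ → ∣ t ∣ ≤ 2 → Corrects p₀ t (correction p₀ t)
correction-corrects {t = + 0}      (inj₁ refl) _ = corrects (inj₂ refl) (inj₁ refl) refl
correction-corrects {t = + 0}      (inj₂ refl) _ = corrects (inj₂ refl) (inj₂ (inj₂ refl)) refl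
correction-corrects {t = + 1}      (inj₁ refl) _ = corrects (inj₂ refl) (inj₂ (inj₁ refl)) refl
correction-corrects {t = + 1}      (inj₂ refl) _ = corrects (inj₂ refl) (inj₂ (inj₁ refl)) refl
correction-corrects {t = + 2}      (inj₁ refl) _ = corrects (inj₂ refl) (inj₂ (inj₂ refl)) refl
correction-corrects {t = + 2}      (inj₂ refl) _ = corrects (inj₂ refl) (inj₁ refl) refl
correction-corrects {t = -[1+ 0 ]} (inj₁ refl) _ = corrects (inj₁ refl) (inj₂ (inj₁ refl)) refl
correction-corrects {t = -[1+ 0 ]} (inj₂ refl) _ = corrects (inj₁ refl) (inj₂ (inj₁ refl)) refl
correction-corrects {t = -[1+ 1 ]} (inj₁ refl) _ = corrects (inj₁ refl) (inj₁ refl) refl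
correction-corrects {t = -[1+ 1 ]} (inj₂ refl) _ = corrects (inj₁ refl) (inj₂ (inj₂ refl)) refl
correction-corrects {t = + suc (suc (suc _))}  _ (s≤s (s≤s ()))
correction-corrects {t = -[1+ suc (suc _) ]}   _ (s≤s (s≤s ()))

applyUpTo-nonempty : ∀ {A : Set} (f : ℕ → A) {T} → 0 < T → applyUpTo f T ≢ []
applyUpTo-nonempty f {suc T} _ ()

module SparseMultiple (p₀ : ℤ) (p₀-lit : LittlewoodCoeff p₀) (u : Poly) (a : ℤ)
                      (u-borwein : All BorweinCoeff u) (a-lit : LittlewoodCoeff a)
                      (sparse : nnz (u ∷ʳ a) ≤ 2) where

  open ≡-Reasoning
  open Corrects

  P′ : Poly
  P′ = u ∷ʳ a

  P : Poly
  P = p₀ ∷ P′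

  d : ℕ
  d = suc (length u)

  P′-borwein : All BorweinCoeff P′
  P′-borwein = Allₚ.∷ʳ⁺ u-borwein (littlewood⇒borwein a-lit)

  -- history k = r_{k-1}, …, r_0 followed by d zeros, and r_k is chosen so that the
  -- coefficient p₀ r_k + (P′ R)_{k-1} of X^k in P R is ±1.
  history : ℕ → List ℤ
  history zero    = applyDownFrom (λ _ → 0ℤ) d
  history (suc k) = correction p₀ (dot P′ (history k)) ∷ history k

  r : ℕ → ℤ
  r k = correction p₀ (dot P′ (history k))

  history-borwein : ∀ k → All BorweinCoeff (history k)
  ∣dot-history∣≤2 : ∀ k → ∣ dot P′ (history k) ∣ ≤ 2
  r-corrects      : ∀ k → Corrects p₀ (dot P′ (history k)) (r k)
  history-borwein zero    = Allₚ.applyDownFrom⁺₂ _ d (λ _ → inj₂ (inj₁ refl))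
  history-borwein (suc k) = borwein (r-corrects k) ∷ history-borwein k
  ∣dot-history∣≤2 k       = ℕₚ.≤-trans (∣dot∣≤nnz P′-borwein (history-borwein k)) sparse
  r-corrects k            = correction-corrects p₀-lit (∣dot-history∣≤2 k)

  ρ : ℕ → ℤ
  ρ = delay d r

  ρ-borwein : ∀ j → BorweinCoeff (ρ j)
  ρ-borwein = delay-preserves BorweinCoeff d (inj₂ (inj₁ refl)) (borwein ∘ r-corrects)

  history≡window : ∀ k → history k ≡ applyDownFrom ρ (d ℕ.+ k)
  history≡window zero    = trans (applyDownFrom-cong d (sym ∘ delay-< d r))
                                 (cong (applyDownFrom ρ) (sym (ℕₚ.+-identityʳ d)))
  history≡window (suc k) = trans (cong₂ _∷_ (sym (delay-+ d r k)) (history≡window k))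
                                 (cong (applyDownFrom ρ) (sym (ℕₚ.+-suc d k)))

  S : ℕ → Bool
  S = odd ∘ ρ

  S-recurrence : ∀ k → S (d ℕ.+ k) ≡ not (dot₂ P′ (applyDownFrom S (d ℕ.+ k)))
  S-recurrence k = begin
    odd (ρ (d ℕ.+ k))                                   ≡⟨ cong odd (delay-+ d r k) ⟩
    odd (r k)                                           ≡⟨ odd-flips (r-corrects k) ⟩
    not (odd (dot P′ (history k)))                      ≡⟨ cong (not ∘ odd ∘ dot P′) (history≡window k) ⟩
    not (odd (dot P′ (applyDownFrom ρ (d ℕ.+ k))))      ≡⟨ cong not (odd-dot P′-borwein (Allₚ.applyDownFrom⁺₂ ρ _ ρ-borwein)) ⟩
    not (dot₂ P′ (map odd (applyDownFrom ρ (d ℕ.+ k)))) ≡⟨ cong (not ∘ dot₂ P′) (map-applyDownFrom odd ρ (d ℕ.+ k)) ⟩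
    not (dot₂ P′ (applyDownFrom S (d ℕ.+ k)))           ∎

  S-determined : ∀ k → S (length u ℕ.+ suc k) ≡ not (dot₂ u (applyDownFrom S (length u ℕ.+ suc k)) xor S k)
  S-determined k = begin
    S (length u ℕ.+ suc k)                                   ≡⟨ subst (λ m → S m ≡ not (dot₂ P′ (applyDownFrom S m)))
                                                                      (sym (ℕₚ.+-suc (length u) k)) (S-recurrence k) ⟩
    not (dot₂ P′ (applyDownFrom S (length u ℕ.+ suc k)))     ≡⟨ cong not (dot₂-∷ʳ u a S k) ⟩
    not (dot₂ u (applyDownFrom S (length u ℕ.+ suc k)) xor (odd a ∧ S k))
                                                             ≡⟨ cong (λ b → not (dot₂ u (applyDownFrom S (length u ℕ.+ suc k)) xor (b ∧ S k)))
                                                                     (odd-littlewood a-lit) ⟩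
    not (dot₂ u (applyDownFrom S (length u ℕ.+ suc k)) xor S k) ∎

  -- The last coefficient a of P′ is odd, so the window after k determines S k.
  S-backward : ∀ {k k′} → SameWindow S d (suc k) (suc k′) → SameWindow S d k k′
  S-backward {k} {k′} same {suc i} (s≤s i<l) =
    subst₂ (λ x y → S x ≡ S y) (sym (ℕₚ.+-suc k i)) (sym (ℕₚ.+-suc k′ i)) (same (ℕₚ.m<n⇒m<1+n i<l))
  S-backward {k} {k′} same {zero} _ =
    subst₂ (λ x y → S x ≡ S y) (sym (ℕₚ.+-identityʳ k)) (sym (ℕₚ.+-identityʳ k′)) (not-xor-cancelˡ X (S k) (S k′) (begin
      not (X xor S k)         ≡⟨ sym (S-determined k) ⟩
      S (length u ℕ.+ suc k)  ≡⟨ subst₂ (λ x y → S x ≡ S y) (ℕₚ.+-comm (suc k) (length u)) (ℕₚ.+-comm (suc k′) (length u))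
                                        (same ℕₚ.≤-refl) ⟩
      S (length u ℕ.+ suc k′) ≡⟨ S-determined k′ ⟩
      not (X′ xor S k′)       ≡⟨ cong (λ x → not (x xor S k′)) (sym (dot₂-window-cong u S (same ∘ ℕₚ.m<n⇒m<1+n))) ⟩
      not (X xor S k′)        ∎))
    where
    X  = dot₂ u (applyDownFrom S (length u ℕ.+ suc k))
    X′ = dot₂ u (applyDownFrom S (length u ℕ.+ suc k′))

  period : ∃ λ T → 0 < T × SameWindow S d 0 T
  period = window-returns S d S-backward

  T : ℕ
  T = proj₁ period

  ρ-vanishes : ∀ {j} → T ≤ j → j < d ℕ.+ T → ρ j ≡ 0ℤ
  ρ-vanishes {j} T≤j j<d+T = odd≡false⇒0 (ρ-borwein j) (begin
    S j                ≡⟨ cong S (sym (ℕₚ.m+[n∸m]≡n T≤j)) ⟩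
    S (T ℕ.+ (j ∸ T))  ≡⟨ sym (proj₂ (proj₂ period) j∸T<d) ⟩
    S (j ∸ T)          ≡⟨ cong odd (delay-< d r j∸T<d) ⟩
    false              ∎)
    where
    j∸T<d : j ∸ T < d
    j∸T<d = subst (j ∸ T <_) (ℕₚ.m+n∸n≡m d T) (ℕₚ.∸-monoˡ-< j<d+T T≤j)

  R : Poly
  R = applyUpTo r T

  g : ℕ → ℤ
  g = delay d (coeff R)

  g≡ρ : ∀ {j} → j < d ℕ.+ T → g j ≡ ρ j
  g≡ρ = delay-cong d (coeff-applyUpTo r)

  g-vanishes : ∀ {j} → T ≤ j → g j ≡ 0ℤ
  g-vanishes {j} T≤j with j ℕ.<? d ℕ.+ T
  ... | yes j<d+T = trans (g≡ρ j<d+T) (ρ-vanishes T≤j j<d+T)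
  ... | no  j≮d+T = delay-coeff-≥ d R
    (subst (λ t → d ℕ.+ t ≤ j) (sym (Listₚ.length-applyUpTo r T)) (ℕₚ.≮⇒≥ j≮d+T))

  coeff-PR-< : ∀ {n} → n < T → coeff (P *ₚ R) n ≡ p₀ * r n + dot P′ (history n)
  coeff-PR-< {n} n<T = begin
    coeff (P *ₚ R) n                                          ≡⟨ coeff-*ₚ d P R n ⟩
    p₀ * g (d ℕ.+ n) + dot P′ (applyDownFrom g (d ℕ.+ n))     ≡⟨ cong₂ (λ x w → p₀ * x + dot P′ w)
                                                                   (trans (g≡ρ d+n<d+T) (delay-+ d r n))
                                                                   (applyDownFrom-cong (d ℕ.+ n) (g≡ρ ∘ (λ j< → ℕₚ.<-trans j< d+n<d+T))) ⟩
    p₀ * r n + dot P′ (applyDownFrom ρ (d ℕ.+ n))             ≡⟨ cong (λ w → p₀ * r n + dot P′ w) (sym (history≡window n)) ⟩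
    p₀ * r n + dot P′ (history n)                             ∎
    where
    d+n<d+T = ℕₚ.+-monoʳ-< d n<T

  coeff-PR-≥ : ∀ {n} → T ≤ n → coeff (P *ₚ R) n ≡ 0ℤ
  coeff-PR-≥ {n} T≤n = trans (coeff-*ₚ d P R n)
    (dot-window-≡0 P g (suc (d ℕ.+ n)) (λ in-window _ → g-vanishes (ℕₚ.≤-trans T≤n (n≤ in-window))))
    where
    length-P′ : length P′ ≡ d
    length-P′ = trans (Listₚ.length-++ u) (ℕₚ.+-comm (length u) 1)
    n≤ : ∀ {j} → suc (d ℕ.+ n) ≤ length P ℕ.+ j → n ≤ j
    n≤ {j} (s≤s le) = ℕₚ.+-cancelˡ-≤ d n j (subst (λ l → d ℕ.+ n ≤ l ℕ.+ j) length-P′ le)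

  Q : Poly
  Q = applyUpTo (coeff (P *ₚ R)) T

  Q-littlewood : IsLittlewood Q
  Q-littlewood = applyUpTo-nonempty _ (proj₁ (proj₂ period))
               , Allₚ.applyUpTo⁺₁ _ T (λ {n} n<T → subst LittlewoodCoeff (sym (coeff-PR-< n<T)) (sum-littlewood (r-corrects n)))

  P∣Q : P ∣ₚ Q
  P∣Q = R , coeff-PR≡Q
    where
    coeff-PR≡Q : ∀ n → coeff (P *ₚ R) n ≡ coeff Q n
    coeff-PR≡Q n with n ℕ.<? T
    ... | yes n<T = sym (coeff-applyUpTo _ n<T)
    ... | no  n≮T = trans (coeff-PR-≥ (ℕₚ.≮⇒≥ n≮T)) (sym (coeff-applyUpTo-≥ _ (ℕₚ.≮⇒≥ n≮T)))

leadCoeff-∷ʳ : ∀ p₀ u a → leadCoeff (p₀ ∷ u ∷ʳ a) ≡ just a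
leadCoeff-∷ʳ p₀ []      a = refl
leadCoeff-∷ʳ p₀ (b ∷ u) a = leadCoeff-∷ʳ b u a

nnz-∷-littlewood : ∀ {p₀} p → LittlewoodCoeff p₀ → nnz (p₀ ∷ p) ≡ suc (nnz p)
nnz-∷-littlewood p (inj₁ refl) = refl
nnz-∷-littlewood p (inj₂ refl) = refl

constant-divides-1 : ∀ {p₀} → LittlewoodCoeff p₀ → (p₀ ∷ []) ∣ₚ (1ℤ ∷ [])
constant-divides-1 (inj₁ refl) = -1ℤ ∷ [] , λ { zero → refl ; (suc _) → refl }
constant-divides-1 (inj₂ refl) = 1ℤ ∷ [] , λ { zero → refl ; (suc _) → refl }

littlewood-multiple : ∀ {p₀ P′} → LittlewoodCoeff p₀ → All BorweinCoeff P′ → NonzeroM (leadCoeff (p₀ ∷ P′)) →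
                      nnz P′ ≤ 2 → InitLast P′ → ∃ λ Q → IsLittlewood Q × (p₀ ∷ P′) ∣ₚ Q
littlewood-multiple p₀-lit _ _ _ [] = 1ℤ ∷ [] , ((λ ()) , inj₂ refl ∷ []) , constant-divides-1 p₀-lit
littlewood-multiple {p₀} p₀-lit P′-borwein lead≢0 sparse (u ∷ʳ′ a) = Q , Q-littlewood , P∣Q
  where
  a-lit = borwein-nonzero⇒littlewood (proj₂ (Allₚ.∷ʳ⁻ P′-borwein)) (subst NonzeroM (leadCoeff-∷ʳ p₀ u a) lead≢0)
  open SparseMultiple p₀ p₀-lit u a (proj₁ (Allₚ.∷ʳ⁻ P′-borwein)) a-lit sparse

sparse-divides-Littlewood : ∀ P → IsBorwein P → nnz P ≤ 3 → ∃ λ Q → IsLittlewood Q × P ∣ₚ Q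
sparse-divides-Littlewood []        (_ , () , _) _
sparse-divides-Littlewood (p₀ ∷ P′) (p₀-borwein ∷ P′-borwein , lead≢0 , p₀≢0) nnz≤3 =
  littlewood-multiple p₀-lit P′-borwein lead≢0 (ℕₚ.≤-pred (subst (_≤ 3) (nnz-∷-littlewood P′ p₀-lit) nnz≤3)) (initLast P′)
  where
  p₀-lit = borwein-nonzero⇒littlewood p₀-borwein p₀≢0

P₄-borwein : IsBorwein P₄
P₄-borwein = (inj₂ (inj₂ refl) ∷ inj₂ (inj₂ refl) ∷ inj₂ (inj₁ refl) ∷ inj₁ refl ∷ inj₂ (inj₂ refl) ∷ []) , (λ ()) , (λ ())

corollary2p4 : HasNonDividingBorwein 4
                 × (∀ (k : ℕ) → 1 ≤ k → k < 4 → ¬ HasNonDividingBorwein k)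
corollary2p4 = (P₄ , P₄-borwein , refl , P₄∤Littlewood) , sparse-divides
  where
  sparse-divides : ∀ (k : ℕ) → 1 ≤ k → k < 4 → ¬ HasNonDividingBorwein k
  sparse-divides k _ k<4 (P , P-borwein , nnz≡k , P∤) =
    let (Q , Q-littlewood , P∣Q) = sparse-divides-Littlewood P P-borwein (subst (_≤ 3) (sym nnz≡k) (ℕₚ.≤-pred k<4))
    in P∤ Q Q-littlewood P∣Q
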